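{- Let $n,k$ be integers with $k\ge1$, $n>2k$, and let $c^*$ be a minimum vertex cover of the generalized Petersen graph $P(n,k)$. Then $c^*$ does not contain all of $V$, and its semi-optimal cover satisfies $|\mathrm{so}(c^*)|=|c^*|$.
   Context: The generalized Petersen graph $P(n,k)$ ($n>2k\ge 2$) has vertex set $U\cup V$ with $U=\{u_1,\dots,u_n\}$, $V=\{v_1,\dots,v_n\}$ and edges $u_iu_{i+1}$, $u_iv_i$, $v_iv_{i+k}$ ($i=1,\dots,n$, subscripts modulo $n$). $u_i$ and $v_i$ are twins. For a vertex cover $c$ not containing all of $V$, a strip of $c$ is a maximal set of circularly consecutive vertices $\{v_i,\dots,v_{i+m}\}\subseteq V\cap c$. The semi-optimal cover $\mathrm{so}(c)$ consists of all vertices of $V\cap c$; the twin $u_i$ of every $v_i\in V\setminus c$; and for each strip $\{v_i,\dots,v_{i+m}\}$ of $c$, the vertices $u_{i+1},u_{i+3},\dots$ among $u_i,\dots,u_{i+m}$. -}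

module Defs where

open import Data.Nat using (ℕ; zero; suc; _+_; _*_; _∸_; _≤_; _<_)
open import Data.Nat.DivMod using (_%_; m%n<n)
open import Data.Fin using (Fin; toℕ; fromℕ<)
open import Data.Fin.Subset using (Subset; _∈_; _∉_; ∣_∣)
open import Data.Product using (_×_; Σ; ∃; _,_)
open import Data.Sum using (_⊎_)
open import Relation.Binary.PropositionalEquality using (_≡_)
open import Relation.Nullary using (¬_)

_⊕_ : ∀ {n} → Fin n → ℕ → Fin n
_⊕_ {suc m} i t = fromℕ< (m%n<n (toℕ i + t) (suc m))

prev : ∀ {n} → Fin n → Fin n
prev {n} i = i ⊕ (n ∸ 1)

-- A set of vertices of P(n,k) is a pair (cu , cv) of subsets of indices:
-- u_i is in the set iff i ∈ cu, v_i is in the set iff i ∈ cv.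
VSet : ℕ → Set
VSet n = Subset n × Subset n

size : ∀ {n} → VSet n → ℕ
size (cu , cv) = ∣ cu ∣ + ∣ cv ∣


-- Vertex cover of P(n,k): covers the edges u_i u_{i+1}, u_i v_i, v_i v_{i+k}.
IsVertexCover : (n k : ℕ) → VSet n → Set
IsVertexCover n k (cu , cv) =
  (i : Fin n) →
    ((i ∈ cu) ⊎ ((i ⊕ 1) ∈ cu)) ×
    ((i ∈ cu) ⊎ (i ∈ cv)) ×
    ((i ∈ cv) ⊎ ((i ⊕ k) ∈ cv))

IsMinVertexCover : (n k : ℕ) → VSet n → Set
IsMinVertexCover n k c =
  IsVertexCover n k c × ((d : VSet n) → IsVertexCover n k d → size c ≤ size d)

ContainsAllV : ∀ {n} → VSet n → Set
ContainsAllV {n} (cu , cv) = (i : Fin n) → i ∈ cv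

IsStrip : ∀ {n} → VSet n → Fin n → ℕ → Set
IsStrip (cu , cv) i m =
  ((t : ℕ) → t ≤ m → (i ⊕ t) ∈ cv) × (prev i ∉ cv) × ((i ⊕ suc m) ∉ cv)

InSoU : ∀ {n} → VSet n → Fin n → Set
InSoU c@(cu , cv) j =
  (j ∉ cv) ⊎
  (Σ _ λ i → Σ ℕ λ m → Σ ℕ λ s →
     IsStrip c i m × (suc (2 * s) ≤ m) × (j ≡ i ⊕ suc (2 * s)))

IsSemiOptimal : ∀ {n} → VSet n → VSet n → Set
IsSemiOptimal {n} c@(cu , cv) (su , sv) =
  ((j : Fin n) → (j ∈ su → InSoU c j) × (InSoU c j → j ∈ su)) ×
  ((j : Fin n) → (j ∈ sv → j ∈ cv) × (j ∈ cv → j ∈ sv))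

module Submission where

-- A minimum cover c of P(n,k) cannot contain all of V: some
-- u_i lies in c (the rim edge u_0 u_1 must be covered), and then v_i is
-- redundant, since all its neighbours u_i, v_{i+k}, v_{i-k} are in c.
-- So there is an index b with v_b ∉ c, and the "run length"
--   R(x) = number of consecutive V-vertices of c ending at v_x
-- is well defined (R(x) = 0 if v_x ∉ c, R(x) = 1 + R(x-1) otherwise),
-- computed by walking from b.  The U-part of so(c) is exactly
-- {u_j | R(j) even}: R(j) = 0 when v_j ∉ c, and R(i+t) = t+1 along a strip
-- starting at i.  This set together with V ∩ c is a vertex cover, and
-- j ↦ (j if u_j ∈ c, else j-1) injects it into U ∩ c (two members never
-- collide, because consecutive members of a strip have run lengths of
-- different parity).  Hence |so(c)| ≤ |c|, and minimality of c gives
-- equality.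

open import Defs
open import Data.Bool using (Bool; true; false; not)
open import Data.Empty using (⊥; ⊥-elim)
open import Data.Fin using (Fin; zero; suc; toℕ; fromℕ<)
open import Data.Fin.Properties
  using (toℕ-injective; toℕ-fromℕ<; toℕ<n; toℕ-inject; ¬∀⟶∃¬; ¬∀⟶∃¬-smallest)
  renaming (_≟_ to _≟ᶠ_; suc-injective to fin-suc-injective; 0≢1+n to fin-0≢1+n)
open import Data.Fin.Subset using (Subset; _∈_; _∉_; ∣_∣; _-_; inside; outside)
open import Data.Fin.Subset.Properties
  using (_∈?_; x∈p⇒∣p-x∣<∣p∣; x∈p∧x∉q⇒x∈p─q; x∈⁅y⁆⇒x≡y)
open import Data.Nat using (ℕ; zero; suc; _+_; _*_; _∸_; _≤_; _<_; z≤n; s≤s; z<s; NonZero; _≤?_)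
open import Data.Nat.DivMod using (_%_; %-distribˡ-+; m%n%n≡m%n; [m+n]%n≡m%n; m<n⇒m%n≡m)
open import Data.Nat.Properties
open import Data.Product using (_×_; Σ; _,_; proj₁; proj₂)
open import Data.Sum using (_⊎_; inj₁; inj₂)
open import Data.Vec using (_∷_; []; tabulate; here; there)
open import Data.Vec.Properties using ([]=⇒lookup; lookup⇒[]=; lookup∘tabulate)
open import Function using (_∘_; id)
open import Relation.Binary.PropositionalEquality
open import Relation.Nullary using (¬_; yes; no)

toℕ-⊕ : ∀ {m} (i : Fin (suc m)) d → toℕ (i ⊕ d) ≡ (toℕ i + d) % suc m
toℕ-⊕ i d = toℕ-fromℕ< _

[m%n+o]%n≡[m+o]%n : ∀ m o n .{{_ : NonZero n}} → (m % n + o) % n ≡ (m + o) % n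
[m%n+o]%n≡[m+o]%n m o n = begin
  (m % n + o) % n         ≡⟨ %-distribˡ-+ (m % n) o n ⟩
  (m % n % n + o % n) % n ≡⟨ cong (λ z → (z + o % n) % n) (m%n%n≡m%n m n) ⟩
  (m % n + o % n) % n     ≡⟨ %-distribˡ-+ m o n ⟨
  (m + o) % n             ∎
  where open ≡-Reasoning

⊕-assoc : ∀ {n} (i : Fin n) d e → (i ⊕ d) ⊕ e ≡ i ⊕ (d + e)
⊕-assoc {suc m} i d e = toℕ-injective (begin
  toℕ ((i ⊕ d) ⊕ e)                 ≡⟨ toℕ-⊕ (i ⊕ d) e ⟩
  (toℕ (i ⊕ d) + e) % suc m         ≡⟨ cong (λ z → (z + e) % suc m) (toℕ-⊕ i d) ⟩
  ((toℕ i + d) % suc m + e) % suc m ≡⟨ [m%n+o]%n≡[m+o]%n (toℕ i + d) e (suc m) ⟩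
  (toℕ i + d + e) % suc m           ≡⟨ cong (_% suc m) (+-assoc (toℕ i) d e) ⟩
  (toℕ i + (d + e)) % suc m         ≡⟨ toℕ-⊕ i (d + e) ⟨
  toℕ (i ⊕ (d + e))                 ∎)
  where open ≡-Reasoning

⊕-comm : ∀ {n} (i j : Fin n) → i ⊕ toℕ j ≡ j ⊕ toℕ i
⊕-comm {suc m} i j = toℕ-injective (begin
  toℕ (i ⊕ toℕ j)           ≡⟨ toℕ-⊕ i (toℕ j) ⟩
  (toℕ i + toℕ j) % suc m   ≡⟨ cong (_% suc m) (+-comm (toℕ i) (toℕ j)) ⟩
  (toℕ j + toℕ i) % suc m   ≡⟨ toℕ-⊕ j (toℕ i) ⟨
  toℕ (j ⊕ toℕ i)           ∎)
  where open ≡-Reasoning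

⊕-0 : ∀ {n} (i : Fin n) → i ⊕ 0 ≡ i
⊕-0 {suc m} i = toℕ-injective (begin
  toℕ (i ⊕ 0)           ≡⟨ toℕ-⊕ i 0 ⟩
  (toℕ i + 0) % suc m   ≡⟨ cong (_% suc m) (+-identityʳ (toℕ i)) ⟩
  toℕ i % suc m         ≡⟨ m<n⇒m%n≡m (toℕ<n i) ⟩
  toℕ i                 ∎)
  where open ≡-Reasoning

⊕-n : ∀ {n} (i : Fin n) → i ⊕ n ≡ i
⊕-n {suc m} i = toℕ-injective (begin
  toℕ (i ⊕ suc m)           ≡⟨ toℕ-⊕ i (suc m) ⟩
  (toℕ i + suc m) % suc m   ≡⟨ [m+n]%n≡m%n (toℕ i) (suc m) ⟩
  toℕ i % suc m             ≡⟨ m<n⇒m%n≡m (toℕ<n i) ⟩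
  toℕ i                     ∎)
  where open ≡-Reasoning

prev-⊕suc : ∀ {n} (i : Fin n) d → prev (i ⊕ suc d) ≡ i ⊕ d
prev-⊕suc {suc m} i d = begin
  (i ⊕ suc d) ⊕ m   ≡⟨ ⊕-assoc i (suc d) m ⟩
  i ⊕ (suc d + m)   ≡⟨ cong (i ⊕_) (+-suc d m) ⟨
  i ⊕ (d + suc m)   ≡⟨ ⊕-assoc i d (suc m) ⟨
  (i ⊕ d) ⊕ suc m   ≡⟨ ⊕-n (i ⊕ d) ⟩
  i ⊕ d             ∎
  where open ≡-Reasoning

prev-⊕1 : ∀ {n} (i : Fin n) → prev (i ⊕ 1) ≡ i
prev-⊕1 i = trans (prev-⊕suc i 0) (⊕-0 i)

⊕1-prev : ∀ {n} (i : Fin n) → prev i ⊕ 1 ≡ i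
⊕1-prev {suc m} i = begin
  (i ⊕ m) ⊕ 1   ≡⟨ ⊕-assoc i m 1 ⟩
  i ⊕ (m + 1)   ≡⟨ cong (i ⊕_) (+-comm m 1) ⟩
  i ⊕ suc m     ≡⟨ ⊕-n i ⟩
  i             ∎
  where open ≡-Reasoning

prev-injective : ∀ {n} {x y : Fin n} → prev x ≡ prev y → x ≡ y
prev-injective {x = x} {y} eq = trans (sym (⊕1-prev x)) (trans (cong (_⊕ 1) eq) (⊕1-prev y))

-- The forward distance from a to x: the unique d < n with a ⊕ d ≡ x.
gap : ∀ {n} → Fin n → Fin n → ℕ
gap {suc m} a x = toℕ (x ⊕ (suc m ∸ toℕ a))

gap<n : ∀ {n} (a x : Fin n) → gap a x < n
gap<n {suc m} a x = toℕ<n _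

⊕-gap : ∀ {n} (a x : Fin n) → a ⊕ gap a x ≡ x
⊕-gap {suc m} a x = begin
  a ⊕ toℕ (x ⊕ (suc m ∸ toℕ a))   ≡⟨ ⊕-comm a (x ⊕ (suc m ∸ toℕ a)) ⟩
  (x ⊕ (suc m ∸ toℕ a)) ⊕ toℕ a   ≡⟨ ⊕-assoc x (suc m ∸ toℕ a) (toℕ a) ⟩
  x ⊕ (suc m ∸ toℕ a + toℕ a)     ≡⟨ cong (x ⊕_) (m∸n+n≡m (<⇒≤ (toℕ<n a))) ⟩
  x ⊕ suc m                       ≡⟨ ⊕-n x ⟩
  x                               ∎
  where open ≡-Reasoning

gap-⊕ : ∀ {n} (a : Fin n) {d} → d < n → gap a (a ⊕ d) ≡ d
gap-⊕ {suc m} a {d} d<n = begin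
  toℕ ((a ⊕ d) ⊕ (suc m ∸ toℕ a))         ≡⟨ cong toℕ (⊕-assoc a d (suc m ∸ toℕ a)) ⟩
  toℕ (a ⊕ (d + (suc m ∸ toℕ a)))         ≡⟨ toℕ-⊕ a (d + (suc m ∸ toℕ a)) ⟩
  (toℕ a + (d + (suc m ∸ toℕ a))) % suc m ≡⟨ cong (_% suc m) rearrange ⟩
  (d + suc m) % suc m                     ≡⟨ [m+n]%n≡m%n d (suc m) ⟩
  d % suc m                               ≡⟨ m<n⇒m%n≡m d<n ⟩
  d                                       ∎
  where
  open ≡-Reasoning
  a′ = toℕ a
  rearrange : a′ + (d + (suc m ∸ a′)) ≡ d + suc m
  rearrange = begin
    a′ + (d + (suc m ∸ a′)) ≡⟨ +-assoc a′ d _ ⟨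
    a′ + d + (suc m ∸ a′)   ≡⟨ cong (_+ (suc m ∸ a′)) (+-comm a′ d) ⟩
    d + a′ + (suc m ∸ a′)   ≡⟨ +-assoc d a′ _ ⟩
    d + (a′ + (suc m ∸ a′)) ≡⟨ cong (d +_) (m+[n∸m]≡n (<⇒≤ (toℕ<n a))) ⟩
    d + suc m               ∎

⊕-moves : ∀ {n} (x : Fin n) {k} → 0 < k → k < n → x ⊕ k ≢ x
⊕-moves x {k} 0<k k<n eq = <⇒≢ 0<k (begin
  0               ≡⟨ gap-⊕ x (≤-<-trans z≤n k<n) ⟨
  gap x (x ⊕ 0)   ≡⟨ cong (gap x) (trans (⊕-0 x) (sym eq)) ⟩
  gap x (x ⊕ k)   ≡⟨ gap-⊕ x k<n ⟩
  k               ∎)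
  where open ≡-Reasoning

back : ∀ {n} → ℕ → Fin n → Fin n
back zero    x = x
back (suc r) x = prev (back r x)

back-⊕ : ∀ {n} r (x : Fin n) → back r x ⊕ r ≡ x
back-⊕ zero    x = ⊕-0 x
back-⊕ (suc r) x = begin
  prev (back r x) ⊕ suc r     ≡⟨ ⊕-assoc (prev (back r x)) 1 r ⟨
  (prev (back r x) ⊕ 1) ⊕ r   ≡⟨ cong (_⊕ r) (⊕1-prev (back r x)) ⟩
  back r x ⊕ r                ≡⟨ back-⊕ r x ⟩
  x                           ∎
  where open ≡-Reasoning

back-+ : ∀ {n} r s (x : Fin n) → back (r + s) x ≡ back r (back s x)
back-+ zero    s x = refl
back-+ (suc r) s x = cong prev (back-+ r s x)

back-⊕-≤ : ∀ {n} {t t′} (x : Fin n) → t′ ≤ t → back t x ⊕ t′ ≡ back (t ∸ t′) x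
back-⊕-≤ {t = t} {t′} x t′≤t = begin
  back t x ⊕ t′                         ≡⟨ cong (λ s → back s x ⊕ t′) (m+[n∸m]≡n t′≤t) ⟨
  back (t′ + (t ∸ t′)) x ⊕ t′           ≡⟨ cong (_⊕ t′) (back-+ t′ (t ∸ t′) x) ⟩
  back t′ (back (t ∸ t′) x) ⊕ t′        ≡⟨ back-⊕ t′ (back (t ∸ t′) x) ⟩
  back (t ∸ t′) x                       ∎
  where open ≡-Reasoning

back-⊕-≥ : ∀ {n} {t t′} (x : Fin n) → t ≤ t′ → back t x ⊕ t′ ≡ x ⊕ (t′ ∸ t)
back-⊕-≥ {t = t} {t′} x t≤t′ = begin
  back t x ⊕ t′                  ≡⟨ cong (back t x ⊕_) (m+[n∸m]≡n t≤t′) ⟨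
  back t x ⊕ (t + (t′ ∸ t))      ≡⟨ ⊕-assoc (back t x) t (t′ ∸ t) ⟨
  (back t x ⊕ t) ⊕ (t′ ∸ t)      ≡⟨ cong (_⊕ (t′ ∸ t)) (back-⊕ t x) ⟩
  x ⊕ (t′ ∸ t)                   ∎
  where open ≡-Reasoning

injection⇒∣p∣≤∣q∣ : ∀ {n m} (p : Subset n) (q : Subset m) (f : Fin n → Fin m) →
  (∀ x → x ∈ p → f x ∈ q) →
  (∀ x y → x ∈ p → y ∈ p → f x ≡ f y → x ≡ y) →
  ∣ p ∣ ≤ ∣ q ∣
injection⇒∣p∣≤∣q∣ []            q f into inj = z≤n
injection⇒∣p∣≤∣q∣ (outside ∷ p) q f into inj =
  injection⇒∣p∣≤∣q∣ p q (f ∘ suc) (λ x x∈ → into (suc x) (there x∈))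
    (λ x y x∈ y∈ eq → fin-suc-injective (inj _ _ (there x∈) (there y∈) eq))
injection⇒∣p∣≤∣q∣ (inside ∷ p) q f into inj =
  ≤-trans (s≤s rest) (x∈p⇒∣p-x∣<∣p∣ (into zero here))
  where
  avoids : ∀ x → x ∈ p → f (suc x) ∈ q - f zero
  avoids x x∈ = x∈p∧x∉q⇒x∈p─q (into (suc x) (there x∈))
    (λ hit → fin-0≢1+n (inj zero (suc x) here (there x∈) (sym (x∈⁅y⁆⇒x≡y (f zero) hit))))
  rest : ∣ p ∣ ≤ ∣ q - f zero ∣
  rest = injection⇒∣p∣≤∣q∣ p (q - f zero) (f ∘ suc) avoids
    (λ x y x∈ y∈ eq → fin-suc-injective (inj _ _ (there x∈) (there y∈) eq))

-- Parity of natural numbers, as a Boolean (so it can describe a Subset).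
even : ℕ → Bool
even zero          = true
even (suc zero)    = false
even (suc (suc r)) = even r

even-suc : ∀ r → even (suc r) ≡ not (even r)
even-suc zero          = refl
even-suc (suc zero)    = refl
even-suc (suc (suc r)) = even-suc r

even-2* : ∀ h → even (2 * h) ≡ true
even-2* zero    = refl
even-2* (suc h) rewrite *-suc 2 h = even-2* h

even⇒2* : ∀ r → even r ≡ true → Σ ℕ λ h → r ≡ 2 * h
even⇒2* zero          _  = 0 , refl
even⇒2* (suc zero)    ()
even⇒2* (suc (suc r)) ev with even⇒2* r ev
... | h , refl = suc h , sym (*-suc 2 h)

-- Run lengths of V ∩ c, relative to a vertex v_b outside c.  R x counts the
-- members of cv in the maximal block of consecutive members ending at x.
module RunLength {n} (cv : Subset n) (b : Fin n) (b∉cv : b ∉ cv) where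

  run : ℕ → ℕ
  run zero = 0
  run (suc d) with b ⊕ suc d ∈? cv
  ... | yes _ = suc (run d)
  ... | no  _ = 0

  R : Fin n → ℕ
  R x = run (gap b x)

  run-out : ∀ d → b ⊕ d ∉ cv → run d ≡ 0
  run-out zero    _ = refl
  run-out (suc d) ∉cv with b ⊕ suc d ∈? cv
  ... | yes ∈cv = ⊥-elim (∉cv ∈cv)
  ... | no  _   = refl

  run-in : ∀ d → d < n → b ⊕ d ∈ cv → run d ≡ suc (R (prev (b ⊕ d)))
  run-in zero    _   ∈cv = ⊥-elim (b∉cv (subst (_∈ cv) (⊕-0 b) ∈cv))
  run-in (suc d) d<n ∈cv with b ⊕ suc d ∈? cv
  ... | no ∉cv = ⊥-elim (∉cv ∈cv)
  ... | yes _  = cong suc (begin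
    run d                      ≡⟨ cong run (gap-⊕ b (<⇒≤ d<n)) ⟨
    run (gap b (b ⊕ d))        ≡⟨ cong R (prev-⊕suc b d) ⟨
    R (prev (b ⊕ suc d))       ∎)
    where open ≡-Reasoning

  R-out : ∀ x → x ∉ cv → R x ≡ 0
  R-out x x∉ = run-out (gap b x) (subst (_∉ cv) (sym (⊕-gap b x)) x∉)

  R-in : ∀ x → x ∈ cv → R x ≡ suc (R (prev x))
  R-in x x∈ = begin
    run (gap b x)                    ≡⟨ run-in (gap b x) (gap<n b x) (subst (_∈ cv) (sym (⊕-gap b x)) x∈) ⟩
    suc (R (prev (b ⊕ gap b x)))     ≡⟨ cong (suc ∘ R ∘ prev) (⊕-gap b x) ⟩
    suc (R (prev x))                 ∎
    where open ≡-Reasoning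

  R-pos⇒∈ : ∀ x → 0 < R x → x ∈ cv
  R-pos⇒∈ x pos with x ∈? cv
  ... | yes x∈ = x∈
  ... | no  x∉ = ⊥-elim (<⇒≢ pos (sym (R-out x x∉)))

  R-zero⇒∉ : ∀ x → R x ≡ 0 → x ∉ cv
  R-zero⇒∉ x R≡0 x∈ = 0≢1+n (trans (sym R≡0) (R-in x x∈))

  R-back : ∀ r x → r ≤ R x → R (back r x) + r ≡ R x
  back-∈ : ∀ r x → r < R x → back r x ∈ cv

  R-back zero    x _  = +-identityʳ (R x)
  R-back (suc r) x le = begin
    R (prev y) + suc r      ≡⟨ +-suc (R (prev y)) r ⟩
    suc (R (prev y)) + r    ≡⟨ cong (_+ r) (R-in y (back-∈ r x le)) ⟨
    R y + r                 ≡⟨ R-back r x (≤-trans (n≤1+n r) le) ⟩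
    R x                     ∎
    where
    open ≡-Reasoning
    y = back r x

  back-∈ r x r<R = R-pos⇒∈ (back r x)
    (+-cancelʳ-< r 0 (R (back r x)) (subst (r <_) (sym (R-back r x (<⇒≤ r<R))) r<R))

  R-strip : ∀ {cu i m} → IsStrip (cu , cv) i m → ∀ t → t ≤ m → R (i ⊕ t) ≡ suc t
  R-strip {i = i} (inStrip , before∉ , _) zero    t≤m = begin
    R (i ⊕ 0)               ≡⟨ R-in (i ⊕ 0) (inStrip 0 t≤m) ⟩
    suc (R (prev (i ⊕ 0)))  ≡⟨ cong (suc ∘ R ∘ prev) (⊕-0 i) ⟩
    suc (R (prev i))        ≡⟨ cong suc (R-out (prev i) before∉) ⟩
    1                       ∎
    where open ≡-Reasoning
  R-strip {cu} {i} strip@(inStrip , _ , _) (suc t) t≤m = begin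
    R (i ⊕ suc t)               ≡⟨ R-in (i ⊕ suc t) (inStrip (suc t) t≤m) ⟩
    suc (R (prev (i ⊕ suc t)))  ≡⟨ cong (suc ∘ R) (prev-⊕suc i t) ⟩
    suc (R (i ⊕ t))             ≡⟨ cong suc (R-strip {cu} strip t (≤-trans (n≤1+n t) t≤m)) ⟩
    suc (suc t)                 ∎
    where open ≡-Reasoning

  -- Walking forward from any j we eventually leave cv (at b at the latest);
  -- e is the first step at which this happens.
  firstExit : ∀ j → Σ ℕ λ e → (∀ u → u < e → j ⊕ u ∈ cv) × j ⊕ e ∉ cv
  firstExit j = toℕ t , inRun , t∉
    where
    P : Fin n → Set
    P t = j ⊕ toℕ t ∈ cv
    notAll : ¬ (∀ t → P t)
    notAll all = b∉cv (subst (_∈ cv) reachesB (all (fromℕ< (gap<n j b))))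
      where
      reachesB : j ⊕ toℕ (fromℕ< (gap<n j b)) ≡ b
      reachesB = trans (cong (j ⊕_) (toℕ-fromℕ< (gap<n j b))) (⊕-gap j b)
    smallest = ¬∀⟶∃¬-smallest n P (λ t → j ⊕ toℕ t ∈? cv) notAll
    t = proj₁ smallest
    t∉ : ¬ P t
    t∉ = proj₁ (proj₂ smallest)
    inRun : ∀ u → u < toℕ t → j ⊕ u ∈ cv
    inRun u u<t = subst (λ z → j ⊕ z ∈ cv)
      (trans (toℕ-inject (fromℕ< u<t)) (toℕ-fromℕ< u<t)) (proj₂ (proj₂ smallest) (fromℕ< u<t))

  strip-through : ∀ {cu} j t → R j ≡ suc t →
    Σ (Fin n) λ i → Σ ℕ λ m → IsStrip (cu , cv) i m × t ≤ m × j ≡ i ⊕ t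
  strip-through j t Rj with firstExit j
  ... | zero , _ , j∉ =
    ⊥-elim (j∉ (subst (_∈ cv) (sym (⊕-0 j)) (R-pos⇒∈ j (subst (0 <_) (sym Rj) z<s))))
  ... | suc e , inRun , exit∉ =
    i , t + e , (inStrip , before∉ , after∉) , m≤m+n t e , sym (back-⊕ t j)
    where
    i = back t j
    inStrip : ∀ t′ → t′ ≤ t + e → i ⊕ t′ ∈ cv
    inStrip t′ t′≤m with t′ ≤? t
    ... | yes t′≤t = subst (_∈ cv) (sym (back-⊕-≤ j t′≤t))
            (back-∈ (t ∸ t′) j (subst (t ∸ t′ <_) (sym Rj) (s≤s (m∸n≤m t t′))))
    ... | no  t′≰t = subst (_∈ cv) (sym (back-⊕-≥ j (<⇒≤ (≰⇒> t′≰t))))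
            (inRun (t′ ∸ t) (s≤s (subst (t′ ∸ t ≤_) (m+n∸m≡n t e) (∸-monoˡ-≤ t t′≤m))))
    before∉ : prev i ∉ cv
    before∉ = R-zero⇒∉ (back (suc t) j)
      (+-cancelʳ-≡ (suc t) _ 0 (trans (R-back (suc t) j (≤-reflexive (sym Rj))) Rj))
    after∉ : i ⊕ suc (t + e) ∉ cv
    after∉ = subst (_∉ cv) (sym (trans (back-⊕-≥ j (≤-trans (m≤m+n t e) (n≤1+n (t + e)))) (cong (j ⊕_) leftover))) exit∉
      where
      leftover : suc (t + e) ∸ t ≡ suc e
      leftover = trans (cong (_∸ t) (sym (+-suc t e))) (m+n∸m≡n t (suc e))

module SemiOptimalCover {n} (cv : Subset n) (b : Fin n) (b∉cv : b ∉ cv) where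
  open RunLength cv b b∉cv

  soU : Subset n
  soU = tabulate (λ j → even (R j))

  ∈soU⇒even : ∀ {j} → j ∈ soU → even (R j) ≡ true
  ∈soU⇒even {j} j∈ = trans (sym (lookup∘tabulate (λ j → even (R j)) j)) ([]=⇒lookup j∈)

  even⇒∈soU : ∀ {j} → even (R j) ≡ true → j ∈ soU
  even⇒∈soU {j} ev = lookup⇒[]= j soU (trans (lookup∘tabulate (λ j → even (R j)) j) ev)

  ∉cv⇒∈soU : ∀ {j} → j ∉ cv → j ∈ soU
  ∉cv⇒∈soU {j} j∉ = even⇒∈soU (cong even (R-out j j∉))

  -- Odd positions 1, 3, 5, … of a strip have even run length 2, 4, 6, ….
  InSoU⇒∈soU : ∀ {cu} j → InSoU (cu , cv) j → j ∈ soU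
  InSoU⇒∈soU j (inj₁ j∉) = ∉cv⇒∈soU j∉
  InSoU⇒∈soU {cu} j (inj₂ (i , m , s , strip , le , refl)) = even⇒∈soU (begin
    even (R (i ⊕ suc (2 * s)))  ≡⟨ cong even (R-strip {cu} strip (suc (2 * s)) le) ⟩
    even (2 + 2 * s)            ≡⟨ cong even (*-suc 2 s) ⟨
    even (2 * suc s)            ≡⟨ even-2* (suc s) ⟩
    true                        ∎)
    where open ≡-Reasoning

  ∈soU⇒InSoU : ∀ {cu} j → j ∈ soU → InSoU (cu , cv) j
  ∈soU⇒InSoU {cu} j j∈ with j ∈? cv
  ... | no j∉ = inj₁ j∉
  ... | yes j∈cv with even⇒2* (R j) (∈soU⇒even j∈)
  ...   | zero  , R≡0 = ⊥-elim (R-zero⇒∉ j R≡0 j∈cv)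
  ...   | suc s , R≡  with strip-through {cu} j (suc (2 * s)) (trans R≡ (*-suc 2 s))
  ...     | i , m , strip , le , j≡ = inj₂ (i , m , s , strip , le , j≡)

  isSemiOptimal : ∀ cu → IsSemiOptimal (cu , cv) (soU , cv)
  isSemiOptimal cu = (λ j → ∈soU⇒InSoU {cu} j , InSoU⇒∈soU {cu} j) , (λ j → id , id)

  R-⊕1 : ∀ j → j ⊕ 1 ∈ cv → R (j ⊕ 1) ≡ suc (R j)
  R-⊕1 j j1∈ = trans (R-in (j ⊕ 1) j1∈) (cong (suc ∘ R) (prev-⊕1 j))

  module _ {k} {cu : Subset n} (cov : IsVertexCover n k (cu , cv)) where

    -- soU ∪ cv is a cover: a rim edge u_j u_{j+1} with R j odd has
    -- either v_{j+1} ∉ c or R (j + 1) = R j + 1 even.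
    so-cover : IsVertexCover n k (soU , cv)
    so-cover j = rim , spoke , proj₂ (proj₂ (cov j))
      where
      spoke : j ∈ soU ⊎ j ∈ cv
      spoke with j ∈? cv
      ... | yes j∈ = inj₂ j∈
      ... | no  j∉ = inj₁ (∉cv⇒∈soU j∉)
      rim : j ∈ soU ⊎ j ⊕ 1 ∈ soU
      rim with even (R j) in ev
      ... | true  = inj₁ (even⇒∈soU ev)
      ... | false with j ⊕ 1 ∈? cv
      ...   | no  j1∉ = inj₂ (∉cv⇒∈soU j1∉)
      ...   | yes j1∈ = inj₂ (even⇒∈soU (begin
        even (R (j ⊕ 1))    ≡⟨ cong even (R-⊕1 j j1∈) ⟩
        even (suc (R j))    ≡⟨ even-suc (R j) ⟩
        not (even (R j))    ≡⟨ cong not ev ⟩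
        true                ∎))
        where open ≡-Reasoning

    charge : Fin n → Fin n
    charge j with j ∈? cu
    ... | yes _ = j
    ... | no  _ = prev j

    charge-cases : ∀ j → (charge j ≡ j × j ∈ cu) ⊎ (charge j ≡ prev j × j ∉ cu)
    charge-cases j with j ∈? cu
    ... | yes j∈ = inj₁ (refl , j∈)
    ... | no  j∉ = inj₂ (refl , j∉)

    -- If u_j ∉ c then the rim edge u_{j-1} u_j forces u_{j-1} ∈ c.
    charge-∈ : ∀ j → charge j ∈ cu
    charge-∈ j with charge-cases j
    ... | inj₁ (eq , j∈) = subst (_∈ cu) (sym eq) j∈
    ... | inj₂ (eq , j∉) with proj₁ (cov (prev j))
    ...   | inj₁ pj∈ = subst (_∈ cu) (sym eq) pj∈
    ...   | inj₂ j∈  = ⊥-elim (j∉ (subst (_∈ cu) (⊕1-prev j) j∈))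

    -- Two members x = y - 1 of soU with u_y ∉ c cannot occur: then v_y ∈ c,
    -- so R y = R x + 1 and the two run lengths have different parity.
    no-clash : ∀ {x y} → x ∈ soU → y ∈ soU → y ∉ cu → x ≢ prev y
    no-clash {x} {y} x∈ y∈ y∉ x≡ with proj₁ (proj₂ (cov y))
    ... | inj₁ y∈cu = y∉ y∈cu
    ... | inj₂ y∈cv = false≢true (begin
      false               ≡⟨⟩
      not true            ≡⟨ cong not (∈soU⇒even x∈) ⟨
      not (even (R x))    ≡⟨ even-suc (R x) ⟨
      even (suc (R x))    ≡⟨ cong (even ∘ suc ∘ R) x≡ ⟩
      even (suc (R (prev y))) ≡⟨ cong even (R-in y y∈cv) ⟨
      even (R y)          ≡⟨ ∈soU⇒even y∈ ⟩
      true                ∎)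
      where
      open ≡-Reasoning
      false≢true : false ≢ true
      false≢true ()

    charge-injective : ∀ x y → x ∈ soU → y ∈ soU → charge x ≡ charge y → x ≡ y
    charge-injective x y x∈ y∈ eq with charge-cases x | charge-cases y
    ... | inj₁ (ex , _)  | inj₁ (ey , _)  = trans (sym ex) (trans eq ey)
    ... | inj₁ (ex , _)  | inj₂ (ey , y∉) = ⊥-elim (no-clash x∈ y∈ y∉ (trans (sym ex) (trans eq ey)))
    ... | inj₂ (ex , x∉) | inj₁ (ey , _)  = ⊥-elim (no-clash y∈ x∈ x∉ (trans (sym ey) (trans (sym eq) ex)))
    ... | inj₂ (ex , _)  | inj₂ (ey , _)  = prev-injective (trans (sym ex) (trans eq ey))

    ∣soU∣≤∣cu∣ : ∣ soU ∣ ≤ ∣ cu ∣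
    ∣soU∣≤∣cu∣ = injection⇒∣p∣≤∣q∣ soU cu charge (λ x _ → charge-∈ x) charge-injective

-- If V ⊆ c and u_i ∈ c then v_i is redundant: all its neighbours
-- u_i, v_{i+k}, v_{i-k} are in c (here 0 < k < n makes v_{i+k} ≠ v_i).
drop-v : ∀ {n k} {cu cv : Subset n} {i} → 0 < k → k < n →
  IsVertexCover n k (cu , cv) → (∀ x → x ∈ cv) → i ∈ cu →
  IsVertexCover n k (cu , cv - i)
drop-v {_} {k} {cu} {cv} {i} 0<k k<n cov allV i∈cu x = proj₁ (cov x) , spoke , rung
  where
  keep : ∀ {y} → y ≢ i → y ∈ cv - i
  keep ne = x∈p∧x∉q⇒x∈p─q (allV _) (ne ∘ x∈⁅y⁆⇒x≡y i)
  spoke : x ∈ cu ⊎ x ∈ cv - i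
  spoke with x ≟ᶠ i
  ... | yes refl = inj₁ i∈cu
  ... | no  x≢i  = inj₂ (keep x≢i)
  rung : x ∈ cv - i ⊎ x ⊕ k ∈ cv - i
  rung with x ≟ᶠ i
  ... | yes refl = inj₂ (keep (⊕-moves x 0<k k<n))
  ... | no  x≢i  = inj₁ (keep x≢i)

minCover-misses-V : ∀ {n k} (c : VSet n) → 0 < k → k < n →
  IsMinVertexCover n k c → ¬ ContainsAllV c
minCover-misses-V {zero} _ _ () _ _
minCover-misses-V {suc m} (cu , cv) 0<k k<n (cov , min) allV =
  <⇒≱ smaller (min (cu , cv - i) (drop-v 0<k k<n cov allV i∈cu))
  where
  -- the rim edge u_0 u_1 puts some u_i into c
  uInCover : Σ (Fin (suc m)) (_∈ cu)
  uInCover with proj₁ (cov zero)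
  ... | inj₁ 0∈ = zero , 0∈
  ... | inj₂ 1∈ = zero ⊕ 1 , 1∈
  i = proj₁ uInCover
  i∈cu = proj₂ uInCover
  smaller : size (cu , cv - i) < size (cu , cv)
  smaller = +-monoʳ-< ∣ cu ∣ (x∈p⇒∣p-x∣<∣p∣ (allV i))

corollary2 : (n k : ℕ) → 1 ≤ k → 2 * k < n → (c : VSet n) →
    IsMinVertexCover n k c →
    ¬ ContainsAllV c ×
    Σ (VSet n) (λ s → IsSemiOptimal c s × size s ≡ size c)
corollary2 n k 1≤k 2k<n c@(cu , cv) isMin@(cov , min) =
  missesV , (soU , cv) , isSemiOptimal cu , sameSize
  where
  k<n : k < n
  k<n = ≤-<-trans (m≤m+n k (k + 0)) 2k<n
  missesV : ¬ ContainsAllV c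
  missesV = minCover-misses-V c 1≤k k<n isMin
  missing = ¬∀⟶∃¬ n (_∈ cv) (_∈? cv) missesV
  open SemiOptimalCover cv (proj₁ missing) (proj₂ missing)
  sameSize : size (soU , cv) ≡ size c
  sameSize = ≤-antisym (+-monoˡ-≤ ∣ cv ∣ (∣soU∣≤∣cu∣ cov)) (min (soU , cv) (so-cover cov))
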